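{- Let $N$ be a set of ground closures of Horn clauses, with candidate interpretation $R_*$. If a closure $(C'\lor u\approx u'\cdot\theta)\in N$ produces $u\theta\to u'\theta$, then $R_*\models(C'\lor u\approx u'\cdot\theta)$ and $R_*\not\models(C'\cdot\theta)$.
   Context: $\succ$ is a reduction ordering on terms, total on ground terms. Clauses are finite multisets of literals $s\approx t$, $s\not\approx t$ ($\approx$ symmetric); a Horn clause has at most one positive literal. A ground closure $(C\cdot\theta)$: clause $C$ and substitution $\theta$ with $C\theta$ ground. For a ground rewrite system $R$, $R\models(C\cdot\theta)$ means $C\theta$ is true in the equational interpretation generated by $R$. For a left-reduced ground rewrite system $R$ contained in $\succ$ there is a well-founded ordering $\succ\!\!\succ_R$ on ground closures (the $R$-normalization closure ordering). Construction from $N$: by induction on ground terms $s$ w.r.t. $\succ$, $R_s=\bigcup_{t\prec s}E_t$, and $E_s=\{s\to s'\}$ if $(C\cdot\theta)$ is the $\succ\!\!\succ_{R_s}$-smallest closure in $N$ such that $C=C'\lor u\approx u'$, $s=u\theta$ is a strictly maximal term in $C\theta$ (all other terms occurring in $C\theta$ are $\prec s$), occurs only in positive literals of $C\theta$, and is $R_s$-irreducible, $s'=u'\theta$, $C\theta$ is false in $R_s$, and $s\succ s'$; in this case $(C\cdot\theta)$ is said to produce $s\to s'$. $E_s=\emptyset$ if no such closure exists. $R_*=\bigcup_tE_t$. -}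

module Defs where

open import Data.Nat using (ℕ; zero; suc; _+_; _≤_)
open import Data.Empty using (⊥)
open import Data.Unit using (⊤)
open import Data.Fin using (Fin)
open import Data.Vec using (Vec; []; _∷_; _[_]≔_)
open import Data.List using (List; []; _∷_; map)
open import Data.List.Relation.Unary.Any using (Any)
open import Data.List.Relation.Unary.All using (All)
open import Data.List.Relation.Binary.Permutation.Propositional using (_↭_)
open import Data.Product using (Σ; ∃; _×_; _,_)
open import Data.Sum using (_⊎_)
open import Relation.Nullary using (¬_)
open import Relation.Binary.PropositionalEquality using (_≡_; _≢_)
open import Relation.Binary.Construct.Closure.Equivalence using (EqClosure)
open import Induction.WellFounded using (WellFounded)

module Sig (F : Set) (arity : F → ℕ) where

  data Term (V : Set) : Set where
    var : V → Term V
    fun : (f : F) → Vec (Term V) (arity f) → Term V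

  GTerm : Set
  GTerm = Term ⊥

  OTerm : Set
  OTerm = Term ℕ

  mutual
    _⟨_⟩ : ∀ {V W} → Term V → (V → Term W) → Term W
    var x ⟨ σ ⟩ = σ x
    fun f ts ⟨ σ ⟩ = fun f (ts ⟨ σ ⟩*)

    _⟨_⟩* : ∀ {V W n} → Vec (Term V) n → (V → Term W) → Vec (Term W) n
    [] ⟨ σ ⟩* = []
    (t ∷ ts) ⟨ σ ⟩* = (t ⟨ σ ⟩) ∷ (ts ⟨ σ ⟩*)

  emb : GTerm → OTerm
  emb t = t ⟨ (λ ()) ⟩

  record ReductionOrdering (_≻_ : OTerm → OTerm → Set) : Set₁ where
    field
      irrefl   : ∀ {s} → ¬ (s ≻ s)
      trans    : ∀ {s t u} → s ≻ t → t ≻ u → s ≻ u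
      wf       : WellFounded (λ t s → s ≻ t)
      monotone : ∀ (f : F) (ts : Vec OTerm (arity f)) (i : Fin (arity f)) {s t}
                 → s ≻ t → fun f (ts [ i ]≔ s) ≻ fun f (ts [ i ]≔ t)
      stable   : ∀ (σ : ℕ → OTerm) {s t} → s ≻ t → (s ⟨ σ ⟩) ≻ (t ⟨ σ ⟩)
      total    : ∀ (s t : GTerm) → (emb s ≻ emb t) ⊎ (s ≡ t) ⊎ (emb t ≻ emb s)

  -- Literals and clauses (a clause is a finite multiset of literals,
  -- represented by a list; lists are compared up to permutation _↭_).
  data Lit (V : Set) : Set where
    _≈ˡ_ : Term V → Term V → Lit V
    _≉ˡ_ : Term V → Term V → Lit V

  Clause : Set
  Clause = List (Lit ℕ)

  GClause : Set
  GClause = List (Lit ⊥)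

  posCount : ∀ {V} → List (Lit V) → ℕ
  posCount [] = 0
  posCount ((s ≈ˡ t) ∷ C) = suc (posCount C)
  posCount ((s ≉ˡ t) ∷ C) = posCount C

  Horn : Clause → Set
  Horn C = posCount C ≤ 1

  substLit : (ℕ → GTerm) → Lit ℕ → Lit ⊥
  substLit θ (s ≈ˡ t) = (s ⟨ θ ⟩) ≈ˡ (t ⟨ θ ⟩)
  substLit θ (s ≉ˡ t) = (s ⟨ θ ⟩) ≉ˡ (t ⟨ θ ⟩)

  record Closure : Set where
    constructor _·_
    field
      clause : Clause
      θ      : ℕ → GTerm
  open Closure public

  inst : Closure → GClause
  inst (C · θ) = map (substLit θ) C

  GRS : Set₁
  GRS = GTerm → GTerm → Set

  data Step (R : GRS) : GTerm → GTerm → Set where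
    root : ∀ {l r} → R l r → Step R l r
    arg  : ∀ (f : F) (ts : Vec GTerm (arity f)) (i : Fin (arity f)) {s t}
           → Step R s t → Step R (fun f (ts [ i ]≔ s)) (fun f (ts [ i ]≔ t))

  Conv : GRS → GTerm → GTerm → Set
  Conv R = EqClosure (Step R)

  TrueLit : GRS → Lit ⊥ → Set
  TrueLit R (s ≈ˡ t) = Conv R s t
  TrueLit R (s ≉ˡ t) = ¬ Conv R s t

  TrueClause : GRS → GClause → Set
  TrueClause R C = Any (TrueLit R) C

  _⊨_ : GRS → Closure → Set
  R ⊨ cl = TrueClause R (inst cl)

  Irreducible : GRS → GTerm → Set
  Irreducible R s = ∀ t → ¬ Step R s t

  OccursIn : GTerm → Lit ⊥ → Set
  OccursIn u (s ≈ˡ t) = u ≡ s ⊎ u ≡ t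
  OccursIn u (s ≉ˡ t) = u ≡ s ⊎ u ≡ t

  IsNeg : Lit ⊥ → Set
  IsNeg (s ≈ˡ t) = ⊥
  IsNeg (s ≉ˡ t) = ⊤

  module Construction (_≻_ : OTerm → OTerm → Set)
                      (_≻≻[_]_ : Closure → GRS → Closure → Set)
                      (N : Closure → Set) where

    _≻g_ : GTerm → GTerm → Set
    s ≻g t = emb s ≻ emb t

    -- the conditions on (C · θ), s and s' = u'θ in the definition of E_s
    -- (with respect to the current rewrite system R = R_s)
    Eligible : GRS → Closure → GTerm → GTerm → Set
    Eligible R cl s s' =
      Σ Clause λ C' → Σ OTerm λ u → Σ OTerm λ u' →
        ((clause cl ↭ ((u ≈ˡ u') ∷ C')) ⊎ (clause cl ↭ ((u' ≈ˡ u) ∷ C')))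
      × (u ⟨ θ cl ⟩ ≡ s)
      × (u' ⟨ θ cl ⟩ ≡ s')
      -- s strictly maximal: every other term occurring in Cθ is ≺ s
      × All (λ L → ∀ t → OccursIn t L → t ≢ s → s ≻g t) (inst cl)
      × All (λ L → IsNeg L → ¬ OccursIn s L) (inst cl)
      × Irreducible R s
      × ¬ (R ⊨ cl)
      × (s ≻g s')

    -- (C · θ) ∈ N produces s → s' w.r.t. R (= R_s): it is eligible and
    -- ≻≻_R-minimal among the closures of N eligible for s.
    Produces : GRS → Closure → GTerm → GTerm → Set
    Produces R cl s s' =
      N cl × Eligible R cl s s'
      × (∀ d → N d → (Σ GTerm λ t' → Eligible R d s t') → ¬ (cl ≻≻[ R ] d))

    -- E : s ↦ E_s (a set of rules),  R_s = ⋃_{t ≺ s} E_t,  R_* = ⋃_t E_t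
    Family : Set₁
    Family = GTerm → GRS

    Rbelow : Family → GTerm → GRS
    Rbelow E s l r = Σ GTerm λ t → (s ≻g t) × E t l r

    Rstar : Family → GRS
    Rstar E l r = Σ GTerm λ t → E t l r

    IsConstruction : Family → Set
    IsConstruction E = ∀ s l r →
      (E s l r → (l ≡ s) × (Σ Closure λ cl → Produces (Rbelow E s) cl s r))
      × ((l ≡ s) × (Σ Closure λ cl → Produces (Rbelow E s) cl s r) → E s l r)

{-# OPTIONS --safe #-}
-- The produced rule uθ → u'θ belongs to R_*, so the head literal of the
-- closure holds in R_*. Since N is Horn, C' has only negative literals;
-- the closure is false in R_{uθ}, so each s ≉ t in C'θ has s, t convertible
-- in R_{uθ}, and convertibility only grows when passing to R_* ⊇ R_{uθ}.
module Submission where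

open import Defs
open import Data.Nat using (ℕ)
open import Data.Nat.Properties using (n<1⇒n≡0)
open import Data.List using ([]; _∷_)
open import Data.List.Relation.Unary.Any using (here; there)
open import Data.Product using (_×_; _,_; proj₂)
open import Relation.Nullary using (¬_)
open import Relation.Binary.Core using (_⇒_)
open import Relation.Binary.PropositionalEquality using (_≡_; refl)
import Relation.Binary.Construct.Closure.Equivalence as EqClosure

module SigProperties (F : Set) (arity : F → ℕ) where
  open Sig F arity

  Step-mono : ∀ {R R' : GRS} → R ⇒ R' → Step R ⇒ Step R'
  Step-mono R⇒R' (root lr)         = root (R⇒R' lr)
  Step-mono R⇒R' (arg f ts i step) = arg f ts i (Step-mono R⇒R' step)

  Conv-mono : ∀ {R R' : GRS} → R ⇒ R' → Conv R ⇒ Conv R'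
  Conv-mono R⇒R' = EqClosure.map (Step-mono R⇒R')

  Horn-tail-negative : ∀ s t C → Horn ((s ≈ˡ t) ∷ C) → posCount C ≡ 0
  Horn-tail-negative s t C = n<1⇒n≡0

  negative-⊭-mono : ∀ {R R' : GRS} → R ⇒ R' → ∀ C θ → posCount C ≡ 0 →
    ¬ (R ⊨ (C · θ)) → ¬ (R' ⊨ (C · θ))
  negative-⊭-mono R⇒R' [] θ neg R⊭C ()
  negative-⊭-mono R⇒R' ((s ≈ˡ t) ∷ C) θ () R⊭C
  negative-⊭-mono R⇒R' ((s ≉ˡ t) ∷ C) θ neg R⊭C (here R'⊭s≈t) =
    R⊭C (here (λ conv → R'⊭s≈t (Conv-mono R⇒R' conv)))
  negative-⊭-mono R⇒R' ((s ≉ˡ t) ∷ C) θ neg R⊭C (there R'⊨C) =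
    negative-⊭-mono R⇒R' C θ neg (λ R⊨C → R⊭C (there R⊨C)) R'⊨C

  module ConstructionProperties (_≻_ : OTerm → OTerm → Set)
                                (_≻≻[_]_ : Closure → GRS → Closure → Set)
                                (N : Closure → Set) where
    open Construction _≻_ _≻≻[_]_ N

    Rbelow⇒Rstar : ∀ E s → Rbelow E s ⇒ Rstar E
    Rbelow⇒Rstar E s (t , _ , rule) = t , rule

    Eligible⇒⊭ : ∀ {R cl s s'} → Eligible R cl s s' → ¬ (R ⊨ cl)
    Eligible⇒⊭ (_ , _ , _ , _ , _ , _ , _ , _ , _ , R⊭cl , _) = R⊭cl

    produced-rule∈Rstar : ∀ {E : Family} → IsConstruction E →
      ∀ {cl s s'} → Produces (Rbelow E s) cl s s' → Rstar E s s'
    produced-rule∈Rstar isConstruction {cl} {s} {s'} produces =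
      s , proj₂ (isConstruction s s s') (refl , cl , produces)

lemma7 : (F : Set) (arity : F → ℕ) →
    let open Sig F arity in
    (_≻_ : OTerm → OTerm → Set) → ReductionOrdering _≻_ →
    (_≻≻[_]_ : Closure → GRS → Closure → Set) →
    (N : Closure → Set) → (∀ cl → N cl → Horn (clause cl)) →
    let open Construction _≻_ _≻≻[_]_ N in
    (E : Family) → IsConstruction E →
    (C' : Clause) (u u' : OTerm) (θ : ℕ → GTerm) →
    Produces (Rbelow E (u ⟨ θ ⟩)) (((u ≈ˡ u') ∷ C') · θ) (u ⟨ θ ⟩) (u' ⟨ θ ⟩) →
    (Rstar E ⊨ (((u ≈ˡ u') ∷ C') · θ)) × ¬ (Rstar E ⊨ (C' · θ))
lemma7 F arity _≻_ _ _≻≻[_]_ N horn E isConstruction C' u u' θ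
       produces@(inN , eligible , _) =
  here (EqClosure.return (root (produced-rule∈Rstar isConstruction produces))) ,
  negative-⊭-mono (Rbelow⇒Rstar E (u ⟨ θ ⟩)) C' θ
    (Horn-tail-negative u u' C' (horn _ inN))
    (λ R⊨C' → Eligible⇒⊭ eligible (there R⊨C'))
  where
    open Sig F arity using (root; _⟨_⟩)
    open SigProperties F arity
    open ConstructionProperties _≻_ _≻≻[_]_ N
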